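{- The only solutions of the equation $2^y+1=3^r(2^{x+1}-1)^w$ in integers $x\ge3$, $y\ge1$, $w\ge0$ and $r\in\mathbb{Z}$ arbitrary are $(x,y,w,r)\in\{(3,2,1,-1),(x,1,0,1),(x,3,0,2)\}$ (with $x\ge3$ arbitrary where it appears as a variable). -}

module Defs where

open import Data.Nat using (ℕ; suc; _+_; _*_; _^_; _∸_)
open import Data.Integer using (ℤ; +_; -[1+_])
open import Relation.Binary.PropositionalEquality using (_≡_)

-- Since 3^r is a rational number when r < 0, we clear the denominator:
--   r = +k       :  2^y + 1 = 3^k * (2^(x+1) - 1)^w
--   r = -(k+1)   :  3^(k+1) * (2^y + 1) = (2^(x+1) - 1)^w
-- (Note 2^(x+1) - 1 ≥ 1, so truncated subtraction ∸ is exact.)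
Eqn : ℕ → ℕ → ℕ → ℤ → Set
Eqn x y w (+ k)      = 2 ^ y + 1 ≡ 3 ^ k * (2 ^ (x + 1) ∸ 1) ^ w
Eqn x y w -[1+ k ]   = 3 ^ suc k * (2 ^ y + 1) ≡ (2 ^ (x + 1) ∸ 1) ^ w

{-# OPTIONS --safe #-}
module Submission where

-- For r = k ≥ 0 and w ≥ 1, M = 2^(x+1) − 1 would divide 2^y + 1; reducing y modulo x + 1 makes
-- 2^y + 1 smaller than M, which is absurd. For w = 0 the equation 2^y + 1 = 3^k is settled by
-- residues modulo 80. For r = −(k+1), 3 ∣ M forces x + 1 = 2h, so M = (2^h − 1)(2^h + 1), and the
-- parts d₁, d₂ of the two factors prime to 3 both divide 2^y + 1. Comparing the 2-adic valuations
-- of h and y yields a common multiple N of h and y such that d₁ or d₂ divides both 2^N − 1 and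
-- 2^N + 1, hence divides 2, hence is 1. So 2^h − 1 or 2^h + 1 is a power of 3, which leaves
-- M = 63, impossible as 7 ∤ 2^y + 1, or M = 15, where w ≥ 2 would give 25 ∣ 2^y + 1 and then
-- 41 ∣ 2^y + 1.

open import Data.Empty using (⊥-elim)
open import Data.Integer using (ℤ; +_; -_; -[1+_])
open import Data.List using (List; []; _∷_)
open import Data.List.Relation.Unary.All using (All; []; _∷_; all?; lookup)
open import Data.List.Relation.Unary.Any using (here)
open import Data.Nat
open import Data.Nat.Coprimality using (Coprime; coprime-divisor)
open import Data.Nat.DivMod
open import Data.Nat.Divisibility
open import Data.Nat.Induction using (<-wellFounded)
open import Data.Nat.Primality
  using (Prime; prime?; ¬prime[1]; prime⇒irreducible; prime⇒nonTrivial; euclidsLemma)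
open import Data.Nat.Properties
open import Data.Nat.Tactic.RingSolver using (solve-∀)
open import Algebra.Properties.CommutativeSemigroup *-commutativeSemigroup using (x∙yz≈y∙xz)
open import Data.List.Membership.DecPropositional _≟_ using (_∈_; _∉_; _∈?_)
open import Data.Product using (∃; ∃₂; _×_; _,_)
open import Data.Sum using (_⊎_; inj₁; inj₂)
open import Defs
open import Function.Bundles using (_⇔_; mk⇔)
open import Induction.WellFounded using (Acc; acc)
open import Relation.Binary.Definitions using (tri<; tri≈; tri>)
open import Relation.Binary.PropositionalEquality
open import Relation.Nullary using (¬_; ¬?; Dec; yes; no; contradiction)
open import Relation.Nullary.Decidable using (True; toWitness; from-yes; from-no; _→-dec_)

^-injectiveʳ : ∀ m {a b} → 1 < m → m ^ a ≡ m ^ b → a ≡ b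
^-injectiveʳ m {a} {b} 1<m eq with <-cmp a b
... | tri< a<b _ _ = contradiction eq (<⇒≢ (^-monoʳ-< m 1<m a<b))
... | tri≈ _ a≡b _ = a≡b
... | tri> _ _ b<a = contradiction (sym eq) (<⇒≢ (^-monoʳ-< m 1<m b<a))

∸1∣^∸1 : ∀ x m → x ∸ 1 ∣ x ^ m ∸ 1
∸1∣^∸1 zero    zero    = ∣-refl
∸1∣^∸1 zero    (suc m) = ∣-refl
∸1∣^∸1 (suc p) zero    = p ∣0
∸1∣^∸1 (suc p) (suc m) with suc p ^ m | m^n>0 (suc p) m | ∸1∣^∸1 (suc p) m
... | suc q | _ | p∣q = ∣m∣n⇒∣m+n p∣q (m∣m*n (suc q))

+1∣^+1 : ∀ x m → ¬ 2 ∣ m → x + 1 ∣ x ^ m + 1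
+1∣^+1 x zero          2∤0   = contradiction (2 ∣0) 2∤0
+1∣^+1 x (suc zero)    _     = ∣-reflexive (cong (_+ 1) (sym (*-identityʳ x)))
+1∣^+1 x (suc (suc m)) 2∤2+m =
  ∣m+n∣m⇒∣n (subst (x + 1 ∣_) (sym (identity x (x ^ m))) (m∣m*n _)) (∣n⇒∣m*n x IH)
  where
  IH : x + 1 ∣ x ^ m + 1
  IH = +1∣^+1 x m (λ 2∣m → 2∤2+m (∣m∣n⇒∣m+n (∣-refl {2}) 2∣m))
  identity : ∀ x X → x * (X + 1) + (x * (x * X) + 1) ≡ (x + 1) * (x * X + 1)
  identity = solve-∀

x²∸1≡[x∸1][x+1] : ∀ x → x ^ 2 ∸ 1 ≡ (x ∸ 1) * (x + 1)
x²∸1≡[x∸1][x+1] zero    = refl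
x²∸1≡[x∸1][x+1] (suc p) = identity p
  where
  identity : ∀ p → p * 1 + p * suc (p * 1) ≡ p * (suc p + 1)
  identity = solve-∀

∣∸1∧∣+1⇒∣2 : ∀ {d} X → d ∣ X ∸ 1 → d ∣ X + 1 → d ∣ 2
∣∸1∧∣+1⇒∣2     zero    _   d∣1   = ∣-trans d∣1 (1∣ 2)
∣∸1∧∣+1⇒∣2 {d} (suc X) d∣X d∣X+2 = ∣m+n∣m⇒∣n (subst (d ∣_) (sym (+-suc X 1)) d∣X+2) d∣X

^∸1∣^*∸1 : ∀ x a m → x ^ a ∸ 1 ∣ x ^ (a * m) ∸ 1
^∸1∣^*∸1 x a m = subst (λ n → x ^ a ∸ 1 ∣ n ∸ 1) (^-*-assoc x a m) (∸1∣^∸1 (x ^ a) m)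

^+1∣^*+1 : ∀ x a m → ¬ 2 ∣ m → x ^ a + 1 ∣ x ^ (a * m) + 1
^+1∣^*+1 x a m 2∤m = subst (λ n → x ^ a + 1 ∣ n + 1) (^-*-assoc x a m) (+1∣^+1 (x ^ a) m 2∤m)

x^[a*2]∸1≡[x^a∸1][x^a+1] : ∀ x a → x ^ (a * 2) ∸ 1 ≡ (x ^ a ∸ 1) * (x ^ a + 1)
x^[a*2]∸1≡[x^a∸1][x^a+1] x a = trans (cong (_∸ 1) (sym (^-*-assoc x a 2))) (x²∸1≡[x∸1][x+1] (x ^ a))

^+1∣^[a*2]∸1 : ∀ x a → x ^ a + 1 ∣ x ^ (a * 2) ∸ 1
^+1∣^[a*2]∸1 x a = subst (x ^ a + 1 ∣_) (sym (x^[a*2]∸1≡[x^a∸1][x^a+1] x a)) (n∣m*n (x ^ a ∸ 1))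

∤⇒coprime : ∀ {p n} → Prime p → ¬ p ∣ n → Coprime n p
∤⇒coprime pp p∤n (i∣n , i∣p) with prime⇒irreducible pp i∣p
... | inj₁ i≡1 = i≡1
... | inj₂ refl = contradiction i∣n p∤n

prime∣^⇒∣ : ∀ {p m} n → Prime p → p ∣ m ^ n → p ∣ m
prime∣^⇒∣ zero    pp p∣1 = contradiction (subst Prime (∣1⇒≡1 p∣1) pp) ¬prime[1]
prime∣^⇒∣ {m = m} (suc n) pp p∣m*m^n with euclidsLemma m (m ^ n) pp p∣m*m^n
... | inj₁ p∣m   = p∣m
... | inj₂ p∣m^n = prime∣^⇒∣ n pp p∣m^n

p∣p^[1+k]*n : ∀ p k n → p ∣ p ^ suc k * n
p∣p^[1+k]*n p k n = ∣m⇒∣m*n n (m∣m*n (p ^ k))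

∣p^*⇒∣ : ∀ {p d} j {n} → Prime p → ¬ p ∣ d → d ∣ p ^ j * n → d ∣ n
∣p^*⇒∣ {d = d} zero {n} _ _ d∣1*n = subst (d ∣_) (*-identityˡ n) d∣1*n
∣p^*⇒∣ {p} {d} (suc j) {n} pp p∤d d∣p^[1+j]*n = ∣p^*⇒∣ j pp p∤d
  (coprime-divisor (∤⇒coprime pp p∤d) (subst (d ∣_) (*-assoc p (p ^ j) n) d∣p^[1+j]*n))

d≡p^a*d′∧d′≡1⇒d≡p^a : ∀ {d} p a {d′} → d ≡ p ^ a * d′ → d′ ≡ 1 → d ≡ p ^ a
d≡p^a*d′∧d′≡1⇒d≡p^a p a refl refl = *-identityʳ (p ^ a)

factorOut : ∀ p .{{_ : NonTrivial p}} n .{{_ : NonZero n}} →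
            ∃₂ λ s u → n ≡ p ^ s * u × ¬ p ∣ u
factorOut p n = go n (<-wellFounded n)
  where
  go : ∀ n .{{_ : NonZero n}} → Acc _<_ n → ∃₂ λ s u → n ≡ p ^ s * u × ¬ p ∣ u
  go n (acc rec) with p ∣? n
  ... | no p∤n = 0 , n , sym (*-identityˡ n) , p∤n
  ... | yes p∣n with go (quotient p∣n) {{quotient≢0 p∣n}} (rec (quotient-< p∣n))
  ...   | s , u , q≡p^s*u , p∤u = suc s , u , n≡p^[1+s]*u , p∤u
    where
    n≡p^[1+s]*u : n ≡ p ^ suc s * u
    n≡p^[1+s]*u = begin
      n                 ≡⟨ m∣n⇒n≡quotient*m p∣n ⟩
      quotient p∣n * p  ≡⟨ cong (_* p) q≡p^s*u ⟩
      p ^ s * u * p     ≡⟨ identity p (p ^ s) u ⟩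
      p * p ^ s * u     ∎
      where
      open ≡-Reasoning
      identity : ∀ p P u → P * u * p ≡ p * P * u
      identity = solve-∀

∣p^*⇒p-free-part-∣ : ∀ {p} → Prime p → ∀ d .{{_ : NonZero d}} j {n} → d ∣ p ^ j * n →
                     ∃₂ λ a d′ → d ≡ p ^ a * d′ × d′ ∣ n
∣p^*⇒p-free-part-∣ {p} pp d j d∣p^j*n with factorOut p {{prime⇒nonTrivial pp}} d
... | a , d′ , refl , p∤d′ =
  a , d′ , refl , ∣p^*⇒∣ j pp p∤d′ (∣-trans (n∣m*n (p ^ a)) d∣p^j*n)

-- With a = 2^s u and b = 2^t v, N = b u is a multiple of a and an odd multiple of b.
∣^∸1∧∣^+1⇒∣2 : ∀ x {s t} u v → s ≤ t → ¬ 2 ∣ u → ∀ {d} →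
               d ∣ x ^ (2 ^ s * u) ∸ 1 → d ∣ x ^ (2 ^ t * v) + 1 → d ∣ 2
∣^∸1∧∣^+1⇒∣2 x {s} u v s≤t 2∤u {d} d∣x^a∸1 d∣x^b+1 with m≤n⇒∃[o]m+o≡n s≤t
... | e , refl = ∣∸1∧∣+1⇒∣2 (x ^ (b * u)) d∣x^bu∸1 d∣x^bu+1
  where
  b = 2 ^ (s + e) * v
  a*2^ev≡b*u : 2 ^ s * u * (2 ^ e * v) ≡ b * u
  a*2^ev≡b*u = begin
    2 ^ s * u * (2 ^ e * v)   ≡⟨ identity (2 ^ s) (2 ^ e) u v ⟩
    2 ^ s * 2 ^ e * v * u     ≡⟨ cong (λ P → P * v * u) (^-distribˡ-+-* 2 s e) ⟨
    2 ^ (s + e) * v * u       ∎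
    where
    open ≡-Reasoning
    identity : ∀ P Q u v → P * u * (Q * v) ≡ P * Q * v * u
    identity = solve-∀
  d∣x^bu∸1 : d ∣ x ^ (b * u) ∸ 1
  d∣x^bu∸1 = subst (λ n → d ∣ x ^ n ∸ 1) a*2^ev≡b*u
    (∣-trans d∣x^a∸1 (^∸1∣^*∸1 x (2 ^ s * u) (2 ^ e * v)))
  d∣x^bu+1 : d ∣ x ^ (b * u) + 1
  d∣x^bu+1 = ∣-trans d∣x^b+1 (^+1∣^*+1 x b u 2∤u)

-- With a = 2^s u and b = 2^t v, N = a v is an odd multiple of a and an even multiple of b.
∣^+1∧∣^+1⇒∣2 : ∀ x {s t} u v → t < s → ¬ 2 ∣ v → ∀ {d} →
               d ∣ x ^ (2 ^ s * u) + 1 → d ∣ x ^ (2 ^ t * v) + 1 → d ∣ 2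
∣^+1∧∣^+1⇒∣2 x {t = t} u v t<s 2∤v {d} d∣x^a+1 d∣x^b+1 with m≤n⇒∃[o]m+o≡n t<s
... | e , refl = ∣∸1∧∣+1⇒∣2 (x ^ (a * v)) d∣x^av∸1 d∣x^av+1
  where
  a = 2 ^ (suc t + e) * u
  b*2*2^eu≡a*v : 2 ^ t * v * 2 * (2 ^ e * u) ≡ a * v
  b*2*2^eu≡a*v = begin
    2 ^ t * v * 2 * (2 ^ e * u)   ≡⟨ identity (2 ^ t) (2 ^ e) u v ⟩
    2 * (2 ^ t * 2 ^ e) * u * v   ≡⟨ cong (λ P → 2 * P * u * v) (^-distribˡ-+-* 2 t e) ⟨
    2 ^ (suc t + e) * u * v       ∎
    where
    open ≡-Reasoning
    identity : ∀ P Q u v → P * v * 2 * (Q * u) ≡ 2 * (P * Q) * u * v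
    identity = solve-∀
  d∣x^av∸1 : d ∣ x ^ (a * v) ∸ 1
  d∣x^av∸1 = subst (λ n → d ∣ x ^ n ∸ 1) b*2*2^eu≡a*v
    (∣-trans d∣x^b+1 (∣-trans (^+1∣^[a*2]∸1 x (2 ^ t * v))
                              (^∸1∣^*∸1 x (2 ^ t * v * 2) (2 ^ e * u))))
  d∣x^av+1 : d ∣ x ^ (a * v) + 1
  d∣x^av+1 = ∣-trans d∣x^a+1 (^+1∣^*+1 x a v 2∤v)

common-divisors-∣2 : ∀ x a b .{{_ : NonZero a}} .{{_ : NonZero b}} {d₁ d₂} →
                     d₁ ∣ x ^ a ∸ 1 → d₁ ∣ x ^ b + 1 → d₂ ∣ x ^ a + 1 → d₂ ∣ x ^ b + 1 →
                     d₁ ∣ 2 ⊎ d₂ ∣ 2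
common-divisors-∣2 x a b d₁∣x^a∸1 d₁∣x^b+1 d₂∣x^a+1 d₂∣x^b+1
  with factorOut 2 a | factorOut 2 b
... | s , u , refl , 2∤u | t , v , refl , 2∤v with ≤-<-connex s t
...   | inj₁ s≤t = inj₁ (∣^∸1∧∣^+1⇒∣2 x u v s≤t 2∤u d₁∣x^a∸1 d₁∣x^b+1)
...   | inj₂ t<s = inj₂ (∣^+1∧∣^+1⇒∣2 x u v t<s 2∤v d₂∣x^a+1 d₂∣x^b+1)

[m*n]%o≡[m*[n%o]]%o : ∀ m n o .{{_ : NonZero o}} → (m * n) % o ≡ (m * (n % o)) % o
[m*n]%o≡[m*[n%o]]%o m n o = begin
  (m * n) % o                ≡⟨ %-distribˡ-* m n o ⟩
  (m % o * (n % o)) % o      ≡⟨ cong (λ z → (m % o * z) % o) (m%n%n≡m%n n o) ⟨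
  (m % o * (n % o % o)) % o  ≡⟨ %-distribˡ-* m (n % o) o ⟨
  (m * (n % o)) % o          ∎
  where open ≡-Reasoning

[m+n]%d≡[m%o+n]%d : ∀ m n {d} o .{{_ : NonZero d}} .{{_ : NonZero o}} → d ∣ o →
                    (m + n) % d ≡ (m % o + n) % d
[m+n]%d≡[m%o+n]%d m n {d} o d∣o = begin
  (m + n) % d                      ≡⟨ cong (λ z → (z + n) % d) (m≡m%n+[m/n]*n m o) ⟩
  (m % o + m / o * o + n) % d      ≡⟨ cong (_% d) (+-assoc (m % o) (m / o * o) n) ⟩
  (m % o + (m / o * o + n)) % d    ≡⟨ cong (λ z → (m % o + z) % d) (+-comm (m / o * o) n) ⟩
  (m % o + (n + m / o * o)) % d    ≡⟨ cong (_% d) (+-assoc (m % o) n (m / o * o)) ⟨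
  (m % o + n + m / o * o) % d      ≡⟨ %-remove-+ʳ (m % o + n) (∣n⇒∣m*n (m / o) d∣o) ⟩
  (m % o + n) % d                  ∎
  where open ≡-Reasoning

Closed : ∀ m .{{_ : NonZero m}} → ℕ → List ℕ → Set
Closed m c S = All (λ r → (c * r) % m ∈ S) S

closed? : ∀ m .{{_ : NonZero m}} c S → Dec (Closed m c S)
closed? m c S = all? (λ r → (c * r) % m ∈? S) S

orbit-∈ : ∀ m .{{_ : NonZero m}} c {a S} → True (closed? m c S) → a % m ∈ S →
          ∀ k → (a * c ^ k) % m ∈ S
orbit-∈ m c {a} {S} closed a∈S zero = subst (λ n → n % m ∈ S) (sym (*-identityʳ a)) a∈S
orbit-∈ m c {a} {S} closed a∈S (suc k) =
  subst (_∈ S) (sym step) (lookup (toWitness closed) (orbit-∈ m c closed a∈S k))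
  where
  step : (a * (c * c ^ k)) % m ≡ (c * ((a * c ^ k) % m)) % m
  step = trans (cong (_% m) (x∙yz≈y∙xz a c (c ^ k))) ([m*n]%o≡[m*[n%o]]%o c (a * c ^ k) m)

^%-∈ : ∀ m .{{_ : NonZero m}} c {S} → True (closed? m c S) → 1 % m ∈ S → ∀ k → c ^ k % m ∈ S
^%-∈ m c {S} closed 1∈S k =
  subst (λ n → n % m ∈ S) (*-identityˡ (c ^ k)) (orbit-∈ m c closed 1∈S k)

∣n+1⇒[n%o+1]%d≡0 : ∀ n {d} o .{{_ : NonZero d}} .{{_ : NonZero o}} → d ∣ o →
                   d ∣ n + 1 → (n % o + 1) % d ≡ 0
∣n+1⇒[n%o+1]%d≡0 n {d} o d∣o d∣n+1 =
  trans (sym ([m+n]%d≡[m%o+n]%d n 1 o d∣o)) (n∣m⇒m%n≡0 (n + 1) d d∣n+1)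

[n%o+1]%d≡0⇒∣n+1 : ∀ n {d} o .{{_ : NonZero d}} .{{_ : NonZero o}} → d ∣ o →
                   (n % o + 1) % d ≡ 0 → d ∣ n + 1
[n%o+1]%d≡0⇒∣n+1 n {d} o d∣o ≡0 =
  m%n≡0⇒n∣m (n + 1) d (trans ([m+n]%d≡[m%o+n]%d n 1 o d∣o) ≡0)

∤n+1-by-residues : ∀ m .{{_ : NonZero m}} n {S} → n % m ∈ S → All (λ r → (r + 1) % m ≢ 0) S →
                   ¬ m ∣ n + 1
∤n+1-by-residues m n n%m∈S S+1≢0 m∣n+1 =
  lookup S+1≢0 n%m∈S (∣n+1⇒[n%o+1]%d≡0 n m ∣-refl m∣n+1)

prime[3] : Prime 3
prime[3] = from-yes (prime? 3)

prime[41] : Prime 41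
prime[41] = from-yes (prime? 41)

3^k%80∈ : ∀ k → 3 ^ k % 80 ∈ 1 ∷ 3 ∷ 9 ∷ 27 ∷ []
3^k%80∈ = ^%-∈ 80 3 _ (here refl)

2^[4+z]%80∈ : ∀ z → 2 ^ (4 + z) % 80 ∈ 16 ∷ 32 ∷ 64 ∷ 48 ∷ []
2^[4+z]%80∈ z = subst (λ n → n % 80 ∈ 16 ∷ 32 ∷ 64 ∷ 48 ∷ []) (sym (^-distribˡ-+-* 2 4 z))
                      (orbit-∈ 80 2 {a = 16} _ (here refl) z)

2^y+1≡3^k⇒ : ∀ y k → 1 ≤ y → 2 ^ y + 1 ≡ 3 ^ k → (y ≡ 1 × k ≡ 1) ⊎ (y ≡ 3 × k ≡ 2)
2^y+1≡3^k⇒ 1 k _ 3≡3^k = inj₁ (refl , ^-injectiveʳ 3 (s<s z<s) (sym 3≡3^k))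
2^y+1≡3^k⇒ 2 k _ 5≡3^k =
  contradiction (subst (λ n → n % 80 ∈ _) (sym 5≡3^k) (3^k%80∈ k)) (from-no (5 ∈? 1 ∷ 3 ∷ 9 ∷ 27 ∷ []))
2^y+1≡3^k⇒ 3 k _ 9≡3^k = inj₂ (refl , ^-injectiveʳ 3 (s<s z<s) (sym 9≡3^k))
2^y+1≡3^k⇒ (suc (suc (suc (suc z)))) k _ eq =
  contradiction (subst (_∈ 1 ∷ 3 ∷ 9 ∷ 27 ∷ []) 3^k%80≡[2^y%80+1]%80 (3^k%80∈ k))
                (lookup no-clash (2^[4+z]%80∈ z))
  where
  3^k%80≡[2^y%80+1]%80 : 3 ^ k % 80 ≡ (2 ^ (4 + z) % 80 + 1) % 80
  3^k%80≡[2^y%80+1]%80 =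
    trans (cong (_% 80) (sym eq)) ([m+n]%d≡[m%o+n]%d (2 ^ (4 + z)) 1 80 ∣-refl)
  no-clash : All (λ r → (r + 1) % 80 ∉ 1 ∷ 3 ∷ 9 ∷ 27 ∷ []) (16 ∷ 32 ∷ 64 ∷ 48 ∷ [])
  no-clash =
    from-yes (all? (λ r → ¬? ((r + 1) % 80 ∈? 1 ∷ 3 ∷ 9 ∷ 27 ∷ [])) (16 ∷ 32 ∷ 64 ∷ 48 ∷ []))

2^h∸1≡3^a⇒h≤2 : ∀ h a → 2 ^ h ∸ 1 ≡ 3 ^ a → h ≤ 2
2^h∸1≡3^a⇒h≤2 h a eq with h ≤? 2
... | yes h≤2 = h≤2
... | no h≰2 with m≤n⇒∃[o]m+o≡n (≰⇒> h≰2)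
...   | z , refl = ⊥-elim
  (∤n+1-by-residues 8 (3 ^ a) {1 ∷ 3 ∷ []} (^%-∈ 8 3 _ (here refl) a) ((λ ()) ∷ (λ ()) ∷ []) 8∣3^a+1)
  where
  2^h≡3^a+1 : 2 ^ (3 + z) ≡ 3 ^ a + 1
  2^h≡3^a+1 = trans (sym (m∸n+n≡m (m^n>0 2 (3 + z)))) (cong (_+ 1) eq)
  8∣3^a+1 : 8 ∣ 3 ^ a + 1
  8∣3^a+1 = subst (8 ∣_) (trans (sym (^-distribˡ-+-* 2 3 z)) 2^h≡3^a+1) (m∣m*n (2 ^ z))

7∤2^y+1 : ∀ y → ¬ 7 ∣ 2 ^ y + 1
7∤2^y+1 y = ∤n+1-by-residues 7 (2 ^ y) {1 ∷ 2 ∷ 4 ∷ []} (^%-∈ 7 2 _ (here refl) y)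
                             ((λ ()) ∷ (λ ()) ∷ (λ ()) ∷ [])

-- 25 ∣ 2^y + 1 forces y ≡ 10 (mod 20), and 2¹⁰ + 1 = 25 · 41.
25∣2^y+1⇒41∣2^y+1 : ∀ y → 25 ∣ 2 ^ y + 1 → 41 ∣ 2 ^ y + 1
25∣2^y+1⇒41∣2^y+1 y 25∣2^y+1 = [n%o+1]%d≡0⇒∣n+1 (2 ^ y) 1025 (divides 25 refl)
  (lookup 25⇒41 2^y%1025∈ (∣n+1⇒[n%o+1]%d≡0 (2 ^ y) 1025 (divides 41 refl) 25∣2^y+1))
  where
  S = 1 ∷ 2 ∷ 4 ∷ 8 ∷ 16 ∷ 32 ∷ 64 ∷ 128 ∷ 256 ∷ 512 ∷ 1024 ∷
      1023 ∷ 1021 ∷ 1017 ∷ 1009 ∷ 993 ∷ 961 ∷ 897 ∷ 769 ∷ 513 ∷ []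
  2^y%1025∈ : 2 ^ y % 1025 ∈ S
  2^y%1025∈ = ^%-∈ 1025 2 _ (here refl) y
  25⇒41 : All (λ r → (r + 1) % 25 ≡ 0 → (r + 1) % 41 ≡ 0) S
  25⇒41 = from-yes (all? (λ r → ((r + 1) % 25 ≟ 0) →-dec ((r + 1) % 41 ≟ 0)) S)

3^[1+k][2^y+1]≡15^w⇒ : ∀ y k w → 3 ^ suc k * (2 ^ y + 1) ≡ 15 ^ w → y ≡ 2 × w ≡ 1 × k ≡ 0
3^[1+k][2^y+1]≡15^w⇒ y k zero eq =
  contradiction (subst (3 ∣_) eq (p∣p^[1+k]*n 3 k _)) (from-no (3 ∣? 1))
3^[1+k][2^y+1]≡15^w⇒ y k 1 eq
  with k | *-cancelˡ-≡ (3 ^ k * (2 ^ y + 1)) 5 3 (trans (sym (*-assoc 3 (3 ^ k) _)) eq)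
... | zero  | 2^y+1+0≡5 = ^-injectiveʳ 2 (s<s z<s) 2^y≡4 , refl , refl
  where
  2^y≡4 : 2 ^ y ≡ 4
  2^y≡4 = +-cancelʳ-≡ 1 (2 ^ y) 4 (trans (sym (+-identityʳ _)) 2^y+1+0≡5)
... | suc j | 3^[1+j]*n≡5 =
  contradiction (subst (3 ∣_) 3^[1+j]*n≡5 (p∣p^[1+k]*n 3 j _)) (from-no (3 ∣? 5))
3^[1+k][2^y+1]≡15^w⇒ y k (suc (suc w)) eq =
  contradiction (prime∣^⇒∣ (2 + w) prime[41] 41∣15^w) (from-no (41 ∣? 15))
  where
  25∣15^w : 25 ∣ 15 ^ (2 + w)
  25∣15^w = subst (25 ∣_) (*-assoc 15 15 (15 ^ w)) (∣m⇒∣m*n {m = 15 * 15} (15 ^ w) (divides 9 refl))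
  25∣2^y+1 : 25 ∣ 2 ^ y + 1
  25∣2^y+1 = ∣p^*⇒∣ (suc k) prime[3] (from-no (3 ∣? 25)) (subst (25 ∣_) (sym eq) 25∣15^w)
  41∣15^w : 41 ∣ 15 ^ (2 + w)
  41∣15^w = subst (41 ∣_) eq (∣n⇒∣m*n (3 ^ suc k) (25∣2^y+1⇒41∣2^y+1 y 25∣2^y+1))

^∸1∣^+1⇒∣^%+1 : ∀ x .{{_ : NonZero x}} m .{{_ : NonZero m}} y →
                x ^ m ∸ 1 ∣ x ^ y + 1 → x ^ m ∸ 1 ∣ x ^ (y % m) + 1
^∸1∣^+1⇒∣^%+1 x m y M∣x^y+1 =
  ∣m+n∣m⇒∣n (subst (x ^ m ∸ 1 ∣_) x^y+1≡ M∣x^y+1) (∣n⇒∣m*n (x ^ r) (^∸1∣^*∸1 x m q))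
  where
  r = y % m
  q = y / m
  P = x ^ (m * q)
  identity : ∀ X P → .{{_ : NonZero P}} → X * P + 1 ≡ X * (P ∸ 1) + (X + 1)
  identity X (suc P) = identity′ X P
    where
    identity′ : ∀ X P → X * suc P + 1 ≡ X * P + (X + 1)
    identity′ = solve-∀
  x^y+1≡ : x ^ y + 1 ≡ x ^ r * (P ∸ 1) + (x ^ r + 1)
  x^y+1≡ = begin
    x ^ y + 1                        ≡⟨ cong (λ n → x ^ n + 1) (m≡m%n+[m/n]*n y m) ⟩
    x ^ (r + q * m) + 1              ≡⟨ cong (λ n → x ^ (r + n) + 1) (*-comm q m) ⟩
    x ^ (r + m * q) + 1              ≡⟨ cong (_+ 1) (^-distribˡ-+-* x r (m * q)) ⟩
    x ^ r * P + 1                    ≡⟨ identity (x ^ r) P {{m^n≢0 x (m * q)}} ⟩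
    x ^ r * (P ∸ 1) + (x ^ r + 1)    ∎
    where open ≡-Reasoning

2^r+1<2^m∸1 : ∀ {r m} → 3 ≤ m → r < m → 2 ^ r + 1 < 2 ^ m ∸ 1
2^r+1<2^m∸1 {r} {suc x} (s≤s 2≤x) (s≤s r≤x) = begin-strict
  2 ^ r + 1             ≤⟨ +-monoˡ-≤ 1 (^-monoʳ-≤ 2 r≤x) ⟩
  2 ^ x + 1             <⟨ +-monoʳ-< (2 ^ x) (s<s z<s) ⟩
  2 ^ x + 3             ≤⟨ +-monoʳ-≤ (2 ^ x) (∸-monoˡ-≤ 1 (^-monoʳ-≤ 2 2≤x)) ⟩
  2 ^ x + (2 ^ x ∸ 1)   ≡⟨ +-∸-assoc (2 ^ x) (m^n>0 2 x) ⟨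
  2 ^ x + 2 ^ x ∸ 1     ≡⟨ cong (λ X → 2 ^ x + X ∸ 1) (+-identityʳ (2 ^ x)) ⟨
  2 ^ suc x ∸ 1         ∎
  where open ≤-Reasoning

2^m∸1∤2^y+1 : ∀ m y → 3 ≤ m → ¬ 2 ^ m ∸ 1 ∣ 2 ^ y + 1
2^m∸1∤2^y+1 m@(suc _) y 3≤m M∣2^y+1 =
  <⇒≱ (2^r+1<2^m∸1 3≤m (m%n<n y m))
      (∣⇒≤ {{>-nonZero (m≤n+m 1 _)}} (^∸1∣^+1⇒∣^%+1 2 m y M∣2^y+1))

3∣2^n∸1⇒2∣n : ∀ n → 3 ∣ 2 ^ n ∸ 1 → 2 ∣ n
3∣2^n∸1⇒2∣n n 3∣2^n∸1 with 2 ∣? n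
... | yes 2∣n = 2∣n
... | no  2∤n = contradiction (∣∸1∧∣+1⇒∣2 (2 ^ n) 3∣2^n∸1 (+1∣^+1 2 n 2∤n)) (from-no (3 ∣? 2))

∣2∧∣2^y+1⇒≡1 : ∀ {d} y → 1 ≤ y → d ∣ 2 → d ∣ 2 ^ y + 1 → d ≡ 1
∣2∧∣2^y+1⇒≡1 (suc y) _ d∣2 d∣2^y+1 = ∣1⇒≡1 (∣m+n∣m⇒∣n d∣2^y+1 (∣-trans d∣2 (m∣m*n (2 ^ y))))

2^h∸1≡3^a⊎2^h+1≡3^b : ∀ h y j → 1 ≤ h → 1 ≤ y →
                       (2 ^ h ∸ 1) * (2 ^ h + 1) ∣ 3 ^ j * (2 ^ y + 1) →
                       (∃ λ a → 2 ^ h ∸ 1 ≡ 3 ^ a) ⊎ (∃ λ b → 2 ^ h + 1 ≡ 3 ^ b)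
2^h∸1≡3^a⊎2^h+1≡3^b h y j 1≤h 1≤y AB∣3^j[2^y+1]
  with ∣p^*⇒p-free-part-∣ prime[3] A {{A≢0}} j (m*n∣⇒m∣ A B AB∣3^j[2^y+1])
     | ∣p^*⇒p-free-part-∣ prime[3] B {{B≢0}} j (m*n∣⇒n∣ A B AB∣3^j[2^y+1])
  where
  A = 2 ^ h ∸ 1
  B = 2 ^ h + 1
  A≢0 : NonZero A
  A≢0 = >-nonZero (∸-monoˡ-≤ 1 (^-monoʳ-≤ 2 1≤h))
  B≢0 : NonZero B
  B≢0 = >-nonZero (m≤n+m 1 (2 ^ h))
... | a , A′ , A≡3^a*A′ , A′∣2^y+1 | b , B′ , B≡3^b*B′ , B′∣2^y+1
  with common-divisors-∣2 2 h y {{>-nonZero 1≤h}} {{>-nonZero 1≤y}}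
         (subst (A′ ∣_) (sym A≡3^a*A′) (n∣m*n (3 ^ a))) A′∣2^y+1
         (subst (B′ ∣_) (sym B≡3^b*B′) (n∣m*n (3 ^ b))) B′∣2^y+1
...   | inj₁ A′∣2 = inj₁ (a , d≡p^a*d′∧d′≡1⇒d≡p^a 3 a A≡3^a*A′ (∣2∧∣2^y+1⇒≡1 y 1≤y A′∣2 A′∣2^y+1))
...   | inj₂ B′∣2 = inj₂ (b , d≡p^a*d′∧d′≡1⇒d≡p^a 3 b B≡3^b*B′ (∣2∧∣2^y+1⇒≡1 y 1≤y B′∣2 B′∣2^y+1))

3^[1+k][2^y+1]≡[2^n∸1]^w⇒ : ∀ n y k w → 4 ≤ n → 1 ≤ y →
                            3 ^ suc k * (2 ^ y + 1) ≡ (2 ^ n ∸ 1) ^ w → n ≡ 4 × y ≡ 2 × w ≡ 1 × k ≡ 0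
3^[1+k][2^y+1]≡[2^n∸1]^w⇒ n y k zero _ _ eq =
  contradiction (subst (3 ∣_) eq (p∣p^[1+k]*n 3 k _)) (from-no (3 ∣? 1))
3^[1+k][2^y+1]≡[2^n∸1]^w⇒ n y k (suc w) 4≤n 1≤y eq
  with 3∣2^n∸1⇒2∣n n (prime∣^⇒∣ (suc w) prime[3] (subst (3 ∣_) eq (p∣p^[1+k]*n 3 k _)))
... | divides h refl
  with *-cancelʳ-≤ 2 h 2 4≤n
...   | 2≤h
  with 2^h∸1≡3^a⊎2^h+1≡3^b h y (suc k) (<⇒≤ 2≤h) 1≤y
         (subst₂ _∣_ (x^[a*2]∸1≡[x^a∸1][x^a+1] 2 h) (sym eq) (m∣m*n ((2 ^ (h * 2) ∸ 1) ^ w)))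
...     | inj₁ (a , 2^h∸1≡3^a) with ≤-antisym (2^h∸1≡3^a⇒h≤2 h a 2^h∸1≡3^a) 2≤h
...       | refl = refl , 3^[1+k][2^y+1]≡15^w⇒ y k (suc w) eq
3^[1+k][2^y+1]≡[2^n∸1]^w⇒ _ y k (suc w) _ 1≤y eq | divides h refl | 2≤h | inj₂ (b , 2^h+1≡3^b)
  with 2^y+1≡3^k⇒ h b (<⇒≤ 2≤h) 2^h+1≡3^b
...       | inj₁ (refl , _) = contradiction 2≤h λ { (s≤s ()) }
...       | inj₂ (refl , _) = ⊥-elim (7∤2^y+1 y 7∣2^y+1)
  where
  7∣2^y+1 : 7 ∣ 2 ^ y + 1
  7∣2^y+1 = ∣p^*⇒∣ (suc k) prime[3] (from-no (3 ∣? 7))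
              (subst (7 ∣_) (sym eq) (∣m⇒∣m*n {m = 63} (63 ^ w) (divides 9 refl)))

Solution : ℕ → ℕ → ℕ → ℤ → Set
Solution x y w r = (x ≡ 3 × y ≡ 2 × w ≡ 1 × r ≡ - (+ 1))
                 ⊎ (y ≡ 1 × w ≡ 0 × r ≡ + 1)
                 ⊎ (y ≡ 3 × w ≡ 0 × r ≡ + 2)

Eqn⇒Solution : ∀ x y w r → 3 ≤ x → 1 ≤ y → Eqn x y w r → Solution x y w r
Eqn⇒Solution x y zero (+ k) _ 1≤y eq with 2^y+1≡3^k⇒ y k 1≤y (trans eq (*-identityʳ (3 ^ k)))
... | inj₁ (refl , refl) = inj₂ (inj₁ (refl , refl , refl))
... | inj₂ (refl , refl) = inj₂ (inj₂ (refl , refl , refl))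
Eqn⇒Solution x y (suc w) (+ k) 3≤x _ eq =
  contradiction (subst (2 ^ (x + 1) ∸ 1 ∣_) (sym eq) (∣n⇒∣m*n (3 ^ k) (m∣m*n _)))
                (2^m∸1∤2^y+1 (x + 1) y (≤-trans 3≤x (m≤m+n x 1)))
Eqn⇒Solution x y w -[1+ k ] 3≤x 1≤y eq
  with 3^[1+k][2^y+1]≡[2^n∸1]^w⇒ (x + 1) y k w (+-monoˡ-≤ 1 3≤x) 1≤y eq
... | x+1≡4 , refl , refl , refl = inj₁ (+-cancelʳ-≡ 1 x 3 x+1≡4 , refl , refl , refl)

Solution⇒Eqn : ∀ x y w r → Solution x y w r → Eqn x y w r
Solution⇒Eqn _ _ _ _ (inj₁ (refl , refl , refl , refl)) = refl
Solution⇒Eqn _ _ _ _ (inj₂ (inj₁ (refl , refl , refl))) = refl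
Solution⇒Eqn _ _ _ _ (inj₂ (inj₂ (refl , refl , refl))) = refl

lemma3 : (x y w : ℕ) → (r : ℤ) → 3 ≤ x → 1 ≤ y →
         (Eqn x y w r ⇔
           ((x ≡ 3 × y ≡ 2 × w ≡ 1 × r ≡ - (+ 1))
            ⊎ (y ≡ 1 × w ≡ 0 × r ≡ + 1)
            ⊎ (y ≡ 3 × w ≡ 0 × r ≡ + 2)))
lemma3 x y w r 3≤x 1≤y = mk⇔ (Eqn⇒Solution x y w r 3≤x 1≤y) (Solution⇒Eqn x y w r)
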